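{- Let $r\ge 0$ and let $A$ be a torsion-free abelian group of rank $r+1$ such that every subgroup of $A$ of rank $r$ is free. If $B$ and $C$ are pure subgroups of $A$ of rank $r$, then the type of $A/B$ equals the type of $A/C$.
   Context: For a torsion-free abelian group of rank $1$, its type is the equivalence class of the characteristic (the sequence of $p$-heights, over all primes $p$, of a nonzero element), where two characteristics are equivalent if they differ in only finitely many places and only by finite amounts. Here $A/B$ and $A/C$ are torsion-free of rank $1$ since $B,C$ are pure of rank $r$. -}

module Defs where

open import Level using (Level; _⊔_; suc)
open import Algebra.Bundles using (AbelianGroup)
open import Data.Nat as ℕ using (ℕ; zero; _<_; _^_)
open import Data.Nat.Primality using (Prime)
open import Data.Integer as ℤ using (ℤ; +_; -[1+_])
open import Data.Fin using (Fin)
import Data.Fin as Fin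
open import Data.Product using (Σ; ∃; _×_; ∃-syntax)
open import Relation.Nullary using (¬_)
open import Relation.Binary.PropositionalEquality using (_≡_)
open import Function.Bundles using (_⇔_)

module _ {c ℓ : Level} (A : AbelianGroup c ℓ) where
  open AbelianGroup A

  _·ℕ_ : ℕ → Carrier → Carrier
  zero ·ℕ a = ε
  ℕ.suc n ·ℕ a = a ∙ (n ·ℕ a)

  _·ℤ_ : ℤ → Carrier → Carrier
  (+ n) ·ℤ a = n ·ℕ a
  -[1+ n ] ·ℤ a = (ℕ.suc n ·ℕ a) ⁻¹

  lincomb : (k : ℕ) → (Fin k → ℤ) → (Fin k → Carrier) → Carrier
  lincomb zero cs vs = ε
  lincomb (ℕ.suc k) cs vs =
    (cs Fin.zero ·ℤ vs Fin.zero) ∙ lincomb k (λ i → cs (Fin.suc i)) (λ i → vs (Fin.suc i))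

  TorsionFree : Set (c ⊔ ℓ)
  TorsionFree = ∀ (n : ℕ) (a : Carrier) → (ℕ.suc n ·ℕ a) ≈ ε → a ≈ ε

  Independent : (k : ℕ) → (Fin k → Carrier) → Set ℓ
  Independent k vs = ∀ (cs : Fin k → ℤ) → lincomb k cs vs ≈ ε → ∀ i → cs i ≡ + 0

  Dependent : (k : ℕ) → (Fin k → Carrier) → Set ℓ
  Dependent k vs = Σ (Fin k → ℤ) λ cs → lincomb k cs vs ≈ ε × ∃[ i ] ¬ (cs i ≡ + 0)

  record Subgroup : Set (suc (c ⊔ ℓ)) where
    field
      _∈S : Carrier → Set (c ⊔ ℓ)
      resp : ∀ {a b} → a ≈ b → a ∈S → b ∈S
      ε∈ : ε ∈S
      ∙∈ : ∀ {a b} → a ∈S → b ∈S → (a ∙ b) ∈S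
      ⁻¹∈ : ∀ {a} → a ∈S → (a ⁻¹) ∈S
  open Subgroup public

  HasRankSub : Subgroup → ℕ → Set (c ⊔ ℓ)
  HasRankSub S r =
    (Σ (Fin r → Carrier) λ vs → (∀ i → (S ∈S) (vs i)) × Independent r vs)
    × (∀ (vs : Fin (ℕ.suc r) → Carrier) → (∀ i → (S ∈S) (vs i)) → Dependent (ℕ.suc r) vs)

  HasRank : ℕ → Set (c ⊔ ℓ)
  HasRank r =
    (Σ (Fin r → Carrier) λ vs → Independent r vs)
    × (∀ (vs : Fin (ℕ.suc r) → Carrier) → Dependent (ℕ.suc r) vs)

  FreeSub : Subgroup → Set (c ⊔ ℓ)
  FreeSub S = Σ ℕ λ k → Σ (Fin k → Carrier) λ vs →
    (∀ i → (S ∈S) (vs i)) × Independent k vs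
    × (∀ s → (S ∈S) s → Σ (Fin k → ℤ) λ cs → lincomb k cs vs ≈ s)

  Pure : Subgroup → Set (c ⊔ ℓ)
  Pure B = ∀ (n : ℕ) (b : Carrier) → (B ∈S) b → (∃[ a ] (n ·ℕ a) ≈ b) →
    ∃[ b' ] ((B ∈S) b' × (n ·ℕ b') ≈ b)

  -- the p-height of the coset x + B in A/B is at least k:
  -- p^k divides x + B in A/B, i.e. x - p^k y ∈ B for some y ∈ A
  QuotHeightGE : Subgroup → Carrier → ℕ → ℕ → Set (c ⊔ ℓ)
  QuotHeightGE B x p k = ∃[ y ] (B ∈S) (x ∙ ((p ^ k) ·ℕ y) ⁻¹)

-- Characteristics given via "height ≥ k" predicates H p k (height in ℕ ∪ {∞}).
-- Two characteristics are equivalent iff they differ at only finitely many primes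
-- (i.e. agree at all primes above some bound N), and differ only by finite amounts
-- (at every prime, one height is ∞ iff the other is).
CharEquiv : {a : Level} → (ℕ → ℕ → Set a) → (ℕ → ℕ → Set a) → Set a
CharEquiv H H' =
  (Σ ℕ λ N → ∀ p → Prime p → N < p → ∀ k → H p k ⇔ H' p k)
  × (∀ p → Prime p → (∀ k → H p k) ⇔ (∀ k → H' p k))

-- type(A/B) = type(A/C): characteristics of nonzero elements of A/B and A/C are equivalent
-- (the type is independent of the chosen nonzero element).
SameQuotType : {c ℓ : Level} (A : AbelianGroup c ℓ) → Subgroup A → Subgroup A → Set (c ⊔ ℓ)
SameQuotType A B C =
  ∀ (x y : AbelianGroup.Carrier A) → ¬ ((B ∈S) x) → ¬ ((C ∈S) y) →
    CharEquiv (QuotHeightGE A B x) (QuotHeightGE A C y)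

{-# OPTIONS --safe #-}
-- A / B and A / C are torsion-free of rank 1: B and C are pure, and r + 2 elements of A are
-- dependent. In such a group two nonzero elements satisfy n x = m z with n, m ≠ 0, so their
-- p-heights differ by at most v_p(n) or v_p(m) and agree for p ∤ n m; hence the characteristic
-- of a nonzero element does not depend on the element. Membership in B is decidable since
-- x ∉ B is given: writing n z ≡ m x (mod B), z ∈ B iff m = 0. So either B = C, or there are
-- b ∈ B ∖ C and c ∈ C ∖ B. In the second case, B and C being free of finite rank, there are
-- M, M' ≠ 0 with M' B ⊆ ℤ b + C and M C ⊆ ℤ c + B. If c = p^K a + β with β ∈ B, write
-- M' β ≡ n b (mod C), so that n b ≡ p^K M' a (mod C). For a common divisor d of n and p^K,
-- purity of C puts γ = (p^K / d) M' a − (n / d) b in C, and d γ ≡ M' c (mod B); with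
-- M γ ≡ s c (mod B) this gives M M' c ≡ d s c, so d ∣ M M'. Thus v_p(n) ≤ v_p(M M') unless
-- K ≤ v_p(M M'), and the p-height of b in A / C is at least K − v_p(M M'); symmetrically for c.
module Submission where

open import Defs
open import Level using (Level; _⊔_; Lift; lift; lower)
open import Algebra.Bundles using (AbelianGroup)
open import Data.Nat using (ℕ; suc)

open import Data.Nat as ℕ using (zero; _+_; _*_; _<_; _^_; ≢-nonZero)
import Data.Nat.Properties as ℕ
open import Data.Nat.Divisibility
  using (_∣_; _∤_; divides; _∣?_; >⇒∤; ∣-trans; ∣1⇒≡1; m∣m*n; *-monoˡ-∣)
open import Data.Nat.Primality using (Prime; prime⇒irreducible; prime⇒nonZero; prime⇒nonTrivial)
open import Data.Nat.Coprimality using (Coprime; coprime-Bézout; coprime-divisor)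
open import Data.Nat.GCD using (module Bézout)
open import Data.Integer as ℤ using (ℤ; +_; -[1+_]; ∣_∣; _⊖_)
import Data.Integer.Properties as ℤ
open import Data.Integer.Divisibility.Signed as ℤ∣ using (∣ᵤ⇒∣) renaming (_∣_ to _∣ℤ_)
open import Data.Fin using (Fin)
open import Data.Fin.Properties using (all?; ¬∀⟶∃¬)
open import Data.Vec.Functional using (_∷_; []; tail)
open import Data.Product using (∃-syntax; _×_; _,_)
open import Data.Sum using (_⊎_; inj₁; inj₂; [_,_]′)
open import Function.Bundles using (_⇔_; mk⇔; Equivalence)
open import Function.Construct.Composition using (_⇔-∘_)
open import Function.Construct.Symmetry using (⇔-sym)
open import Relation.Nullary using (¬_; Dec; yes; no; contradiction)
open import Relation.Binary.PropositionalEquality as ≡ using (_≡_; _≢_)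

-- With H p k read as "p-height ≥ k": H' ≥ H − v_p(n) at every prime p (¬ p ^ suc e ∣ n says v_p(n) ≤ e).
Dominates : {a : Level} → ℕ → (ℕ → ℕ → Set a) → (ℕ → ℕ → Set a) → Set a
Dominates n H H' = ∀ p → Prime p → ∀ e → ¬ p ^ suc e ∣ n → ∀ k → H p (k + e) → H' p k

n<p^n : ∀ {p} → Prime p → ∀ n → n < p ^ n
n<p^n pp zero = ℕ.s≤s ℕ.z≤n
n<p^n {p} pp (suc n) =
  ℕ.≤-<-trans (n<p^n pp n) (ℕ.^-monoʳ-< p (ℕ.nonTrivial⇒n>1 p ⦃ prime⇒nonTrivial pp ⦄) (ℕ.n<1+n n))

module _ {a : Level} {H H' : ℕ → ℕ → Set a} {n : ℕ} (n≢0 : n ≢ 0) (H≼H' : Dominates n H H') where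

  dominates-beyond : ∀ {p} → Prime p → n < p → ∀ k → H p k → H' p k
  dominates-beyond {p} pp n<p k Hk =
    H≼H' p pp 0 p∤n k (≡.subst (H p) (≡.sym (ℕ.+-identityʳ k)) Hk)
    where
    p∤n : p ^ 1 ∤ n
    p∤n = >⇒∤ ⦃ ≢-nonZero n≢0 ⦄ (≡.subst (n <_) (≡.sym (ℕ.*-identityʳ p)) n<p)

  dominates-∞ : ∀ {p} → Prime p → (∀ k → H p k) → ∀ k → H' p k
  dominates-∞ {p} pp H∞ k =
    H≼H' p pp n (>⇒∤ ⦃ ≢-nonZero n≢0 ⦄ (ℕ.<-trans (ℕ.n<1+n n) (n<p^n pp (suc n)))) k (H∞ (k + n))

module _ {a : Level} {H H' : ℕ → ℕ → Set a} where

  dominates⇒charEquiv : ∀ {m n} → m ≢ 0 → n ≢ 0 → Dominates m H H' → Dominates n H' H → CharEquiv H H'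
  dominates⇒charEquiv {m} {n} m≢0 n≢0 H≼H' H'≼H = (m + n , agree) , λ p pp →
    mk⇔ (dominates-∞ {H = H} {H'} m≢0 H≼H' pp) (dominates-∞ {H = H'} {H} n≢0 H'≼H pp)
    where
    agree : ∀ p → Prime p → m + n < p → ∀ k → H p k ⇔ H' p k
    agree p pp m+n<p k = mk⇔
      (dominates-beyond {H = H} {H'} m≢0 H≼H' pp (ℕ.≤-<-trans (ℕ.m≤m+n m n) m+n<p) k)
      (dominates-beyond {H = H'} {H} n≢0 H'≼H pp (ℕ.≤-<-trans (ℕ.m≤n+m n m) m+n<p) k)

  ⇔⇒charEquiv : (∀ p k → H p k ⇔ H' p k) → CharEquiv H H'
  ⇔⇒charEquiv H⇔H' = (0 , λ p _ _ → H⇔H' p) , λ p _ →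
    mk⇔ (λ H∞ k → Equivalence.to (H⇔H' p k) (H∞ k)) (λ H'∞ k → Equivalence.from (H⇔H' p k) (H'∞ k))

  charEquiv-trans : ∀ {H''} → CharEquiv H H' → CharEquiv H' H'' → CharEquiv H H''
  charEquiv-trans ((M , agree) , ∞) ((N , agree') , ∞') =
    (M + N , λ p pp M+N<p k →
      agree' p pp (ℕ.≤-<-trans (ℕ.m≤n+m N M) M+N<p) k ⇔-∘ agree p pp (ℕ.≤-<-trans (ℕ.m≤m+n M N) M+N<p) k)
    , λ p pp → ∞' p pp ⇔-∘ ∞ p pp

*-≢0 : ∀ {m n} → m ≢ 0 → n ≢ 0 → m * n ≢ 0
*-≢0 {m} m≢0 n≢0 mn≡0 with ℕ.m*n≡0⇒m≡0∨n≡0 m mn≡0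
... | inj₁ m≡0 = m≢0 m≡0
... | inj₂ n≡0 = n≢0 n≡0

coprime-* : ∀ {t m n} → Coprime t m → Coprime t n → Coprime t (m * n)
coprime-* {t} {m} t⊥m t⊥n (d∣t , d∣mn) = t⊥n (d∣t , coprime-divisor d⊥m d∣mn)
  where
  d⊥m : Coprime _ m
  d⊥m (e∣d , e∣m) = t⊥m (∣-trans e∣d d∣t , e∣m)

coprime-^ : ∀ {p t} → Prime p → p ∤ t → ∀ J → Coprime t (p ^ J)
coprime-^ pp p∤t zero (_ , d∣1) = ∣1⇒≡1 d∣1
coprime-^ {p} {t} pp p∤t (suc J) = coprime-* t⊥p (coprime-^ pp p∤t J)
  where
  t⊥p : Coprime t p
  t⊥p (d∣t , d∣p) with prime⇒irreducible pp d∣p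
  ... | inj₁ d≡1 = d≡1
  ... | inj₂ ≡.refl = contradiction d∣t p∤t

module Multiples {c ℓ : Level} (G : AbelianGroup c ℓ) where
  open AbelianGroup G
  open import Algebra.Properties.AbelianGroup G
  open import Algebra.Properties.CommutativeMonoid.Mult commutativeMonoid
    using (×-congʳ; ×-homo-+; ×-assocˡ; ×-distrib-+) renaming (_×_ to _×ᵐ_)
  open import Algebra.Properties.CommutativeSemigroup commutativeSemigroup using (interchange)
  open import Relation.Binary.Reasoning.Setoid setoid

  infixr 8 _·_ _⋆_

  _·_ : ℕ → Carrier → Carrier
  _·_ = _·ℕ_ G

  _⋆_ : ℤ → Carrier → Carrier
  _⋆_ = _·ℤ_ G

  ·≈× : ∀ n x → n · x ≈ n ×ᵐ x
  ·≈× zero x = refl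
  ·≈× (suc n) x = ∙-congˡ (·≈× n x)

  ·-cong : ∀ n {x y} → x ≈ y → n · x ≈ n · y
  ·-cong n {x} {y} x≈y = begin
    n · x     ≈⟨ ·≈× n x ⟩
    n ×ᵐ x    ≈⟨ ×-congʳ n x≈y ⟩
    n ×ᵐ y    ≈⟨ ·≈× n y ⟨
    n · y     ∎

  ·-+ : ∀ m n x → (m + n) · x ≈ m · x ∙ n · x
  ·-+ m n x = begin
    (m + n) · x       ≈⟨ ·≈× (m + n) x ⟩
    (m + n) ×ᵐ x      ≈⟨ ×-homo-+ x m n ⟩
    m ×ᵐ x ∙ n ×ᵐ x   ≈⟨ ∙-cong (·≈× m x) (·≈× n x) ⟨
    m · x ∙ n · x     ∎

  ·-* : ∀ m n x → m · (n · x) ≈ (m * n) · x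
  ·-* m n x = begin
    m · (n · x)     ≈⟨ ·-cong m (·≈× n x) ⟩
    m · (n ×ᵐ x)    ≈⟨ ·≈× m (n ×ᵐ x) ⟩
    m ×ᵐ (n ×ᵐ x)   ≈⟨ ×-assocˡ x m n ⟩
    (m * n) ×ᵐ x    ≈⟨ ·≈× (m * n) x ⟨
    (m * n) · x     ∎

  *-· : ∀ m n x → (m * n) · x ≈ n · (m · x)
  *-· m n x = begin
    (m * n) · x   ≡⟨ ≡.cong (_· x) (ℕ.*-comm m n) ⟩
    (n * m) · x   ≈⟨ ·-* n m x ⟨
    n · (m · x)   ∎

  ·-comm : ∀ m n x → m · (n · x) ≈ n · (m · x)
  ·-comm m n x = trans (·-* m n x) (*-· m n x)

  ·-∙ : ∀ n x y → n · (x ∙ y) ≈ n · x ∙ n · y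
  ·-∙ n x y = begin
    n · (x ∙ y)       ≈⟨ ·≈× n (x ∙ y) ⟩
    n ×ᵐ (x ∙ y)      ≈⟨ ×-distrib-+ x y n ⟩
    n ×ᵐ x ∙ n ×ᵐ y   ≈⟨ ∙-cong (·≈× n x) (·≈× n y) ⟨
    n · x ∙ n · y     ∎

  ·-ε : ∀ n → n · ε ≈ ε
  ·-ε zero = refl
  ·-ε (suc n) = trans (identityˡ _) (·-ε n)

  ·-⁻¹ : ∀ n x → n · (x ⁻¹) ≈ (n · x) ⁻¹
  ·-⁻¹ zero x = sym ε⁻¹≈ε
  ·-⁻¹ (suc n) x = trans (∙-congˡ (·-⁻¹ n x)) (⁻¹-∙-comm x (n · x))

  //-cancelˡ : ∀ x a b → (x ∙ a) ∙ (x ∙ b) ⁻¹ ≈ a ∙ b ⁻¹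
  //-cancelˡ x a b = begin
    (x ∙ a) ∙ (x ∙ b) ⁻¹        ≈⟨ ∙-congˡ (⁻¹-∙-comm x b) ⟨
    (x ∙ a) ∙ (x ⁻¹ ∙ b ⁻¹)     ≈⟨ interchange x a (x ⁻¹) (b ⁻¹) ⟩
    (x ∙ x ⁻¹) ∙ (a ∙ b ⁻¹)     ≈⟨ ∙-congʳ (inverseʳ x) ⟩
    ε ∙ (a ∙ b ⁻¹)              ≈⟨ identityˡ _ ⟩
    a ∙ b ⁻¹                    ∎

  ⋆-⊖ : ∀ m n x → (m ⊖ n) ⋆ x ≈ m · x ∙ (n · x) ⁻¹
  ⋆-⊖ zero zero x = sym (trans (identityˡ _) ε⁻¹≈ε)
  ⋆-⊖ zero (suc n) x = sym (identityˡ _)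
  ⋆-⊖ (suc m) zero x = sym (trans (∙-congˡ ε⁻¹≈ε) (identityʳ _))
  ⋆-⊖ (suc m) (suc n) x = begin
    (suc m ⊖ suc n) ⋆ x           ≡⟨ ≡.cong (_⋆ x) (ℤ.[1+m]⊖[1+n]≡m⊖n m n) ⟩
    (m ⊖ n) ⋆ x                   ≈⟨ ⋆-⊖ m n x ⟩
    m · x ∙ (n · x) ⁻¹            ≈⟨ //-cancelˡ x (m · x) (n · x) ⟨
    suc m · x ∙ (suc n · x) ⁻¹    ∎

  ⋆-+ : ∀ i j x → (i ℤ.+ j) ⋆ x ≈ i ⋆ x ∙ j ⋆ x
  ⋆-+ (+ m) (+ n) x = ·-+ m n x
  ⋆-+ (+ m) -[1+ n ] x = ⋆-⊖ m (suc n) x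
  ⋆-+ -[1+ m ] (+ n) x = trans (⋆-⊖ n (suc m) x) (comm _ _)
  ⋆-+ -[1+ m ] -[1+ n ] x = begin
    (suc (suc (m + n)) · x) ⁻¹          ≡⟨ ≡.cong (λ k → (k · x) ⁻¹) (≡.sym (ℕ.+-suc (suc m) n)) ⟩
    ((suc m + suc n) · x) ⁻¹            ≈⟨ ⁻¹-cong (·-+ (suc m) (suc n) x) ⟩
    (suc m · x ∙ suc n · x) ⁻¹          ≈⟨ ⁻¹-∙-comm _ _ ⟨
    (suc m · x) ⁻¹ ∙ (suc n · x) ⁻¹     ∎

  ⋆-neg : ∀ i x → (ℤ.- i) ⋆ x ≈ (i ⋆ x) ⁻¹
  ⋆-neg (+ zero) x = sym ε⁻¹≈ε
  ⋆-neg (+ suc n) x = refl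
  ⋆-neg -[1+ n ] x = sym (⁻¹-involutive _)

  ⋆-ε : ∀ i → i ⋆ ε ≈ ε
  ⋆-ε (+ n) = ·-ε n
  ⋆-ε -[1+ n ] = trans (⁻¹-cong (·-ε (suc n))) ε⁻¹≈ε

  ⋆-cong : ∀ i {x y} → x ≈ y → i ⋆ x ≈ i ⋆ y
  ⋆-cong (+ n) x≈y = ·-cong n x≈y
  ⋆-cong -[1+ n ] x≈y = ⁻¹-cong (·-cong (suc n) x≈y)

  ⋆-·-comm : ∀ i n x → i ⋆ (n · x) ≈ n · (i ⋆ x)
  ⋆-·-comm (+ m) n x = ·-comm m n x
  ⋆-·-comm -[1+ m ] n x = trans (⁻¹-cong (·-comm (suc m) n x)) (sym (·-⁻¹ n (suc m · x)))

  ·-⋆ : ∀ n i x → n · (i ⋆ x) ≈ (+ n ℤ.* i) ⋆ x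
  ·-⋆ n (+ m) x = begin
    n · (m · x)        ≈⟨ ·-* n m x ⟩
    (n * m) · x        ≡⟨ ≡.cong (_⋆ x) (ℤ.pos-* n m) ⟩
    (+ n ℤ.* + m) ⋆ x  ∎
  ·-⋆ n -[1+ m ] x = begin
    n · ((suc m · x) ⁻¹)               ≈⟨ ·-⁻¹ n (suc m · x) ⟩
    (n · (suc m · x)) ⁻¹               ≈⟨ ⁻¹-cong (·-* n (suc m) x) ⟩
    ((n * suc m) · x) ⁻¹               ≈⟨ ⋆-neg (+ (n * suc m)) x ⟨
    (ℤ.- (+ (n * suc m))) ⋆ x          ≡⟨ ≡.cong (λ i → (ℤ.- i) ⋆ x) (ℤ.pos-* n (suc m)) ⟩
    (ℤ.- (+ n ℤ.* + suc m)) ⋆ x        ≡⟨ ≡.cong (_⋆ x) (ℤ.neg-distribʳ-* (+ n) (+ suc m)) ⟩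
    (+ n ℤ.* -[1+ m ]) ⋆ x             ∎

  module _ (S : Subgroup G) where

    ·∈ : ∀ n {x} → (S ∈S) x → (S ∈S) (n · x)
    ·∈ zero x∈S = ε∈ S
    ·∈ (suc n) x∈S = ∙∈ S x∈S (·∈ n x∈S)

    ⋆∈ : ∀ i {x} → (S ∈S) x → (S ∈S) (i ⋆ x)
    ⋆∈ (+ n) x∈S = ·∈ n x∈S
    ⋆∈ -[1+ n ] x∈S = ⁻¹∈ S (·∈ (suc n) x∈S)

    lincomb∈ : ∀ k cs vs → (∀ i → (S ∈S) (vs i)) → (S ∈S) (lincomb G k cs vs)
    lincomb∈ zero cs vs vs∈S = ε∈ S
    lincomb∈ (suc k) cs vs vs∈S =
      ∙∈ S (⋆∈ (cs Fin.zero) (vs∈S Fin.zero)) (lincomb∈ k (tail cs) (tail vs) (λ i → vs∈S (Fin.suc i)))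

    ∙∈⇒∈ : ∀ {x y} → (S ∈S) (x ∙ y) → (S ∈S) y → (S ∈S) x
    ∙∈⇒∈ {x} {y} xy∈S y∈S = resp S xy∙y⁻¹≈x (∙∈ S xy∈S (⁻¹∈ S y∈S))
      where
      xy∙y⁻¹≈x : (x ∙ y) ∙ y ⁻¹ ≈ x
      xy∙y⁻¹≈x = trans (assoc x y (y ⁻¹)) (trans (∙-congˡ (inverseʳ y)) (identityʳ x))

    ·-preimage : ℕ → Subgroup G
    ·-preimage M = record
      { _∈S = λ x → (S ∈S) (M · x)
      ; resp = λ x≈y → resp S (·-cong M x≈y)
      ; ε∈ = resp S (sym (·-ε M)) (ε∈ S)
      ; ∙∈ = λ {x} {y} Mx∈S My∈S → resp S (sym (·-∙ M x y)) (∙∈ S Mx∈S My∈S)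
      ; ⁻¹∈ = λ {x} Mx∈S → resp S (sym (·-⁻¹ M x)) (⁻¹∈ S Mx∈S)
      }

    common-multiple : ∀ k (vs : Fin k → Carrier) → (∀ i → ∃[ m ] m ≢ 0 × (S ∈S) (m · vs i)) →
                      ∃[ M ] M ≢ 0 × (∀ i → (S ∈S) (M · vs i))
    common-multiple zero vs _ = 1 , (λ ()) , λ ()
    common-multiple (suc k) vs multiples∈S
      with multiples∈S Fin.zero | common-multiple k (tail vs) (λ i → multiples∈S (Fin.suc i))
    ... | m , m≢0 , mv₀∈S | M , M≢0 , Mvs∈S = m * M , *-≢0 m≢0 M≢0 , mM·vs∈S
      where
      mM·vs∈S : ∀ i → (S ∈S) ((m * M) · vs i)
      mM·vs∈S Fin.zero = resp S (sym (*-· m M _)) (·∈ M mv₀∈S)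
      mM·vs∈S (Fin.suc i) = resp S (·-* m M _) (·∈ m (Mvs∈S i))

  Divisible : ℕ → Carrier → Set (c ⊔ ℓ)
  Divisible N x = ∃[ y ] x ≈ N · y

  Height : Carrier → ℕ → ℕ → Set (c ⊔ ℓ)
  Height x p k = Divisible (p ^ k) x

  multiples : ℕ → Subgroup G
  multiples N = record
    { _∈S = Divisible N
    ; resp = λ { x≈x' (y , x≈Ny) → y , trans (sym x≈x') x≈Ny }
    ; ε∈ = ε , sym (·-ε N)
    ; ∙∈ = λ { (y , x≈Ny) (y' , x'≈Ny') → y ∙ y' , trans (∙-cong x≈Ny x'≈Ny') (sym (·-∙ N y y')) }
    ; ⁻¹∈ = λ { (y , x≈Ny) → y ⁻¹ , trans (⁻¹-cong x≈Ny) (sym (·-⁻¹ N y)) }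
    }

  multiple-divisible : ∀ m N x → Divisible N ((m * N) · x)
  multiple-divisible m N x = m · x , *-· m N x

  divisible-∣ : ∀ {d N x} → d ∣ N → Divisible N x → Divisible d x
  divisible-∣ (divides q ≡.refl) (y , x≈qdy) = q · y , trans x≈qdy (*-· q _ y)

  -- By Bézout, z = ± (x · (t · z) − (y * N) · z), and both terms lie in N G.
  divisible-coprime : ∀ {t N z} → Coprime t N → Divisible N (t · z) → Divisible N z
  divisible-coprime {t} {N} {z} t⊥N tz∈NG with coprime-Bézout t⊥N
  ... | Bézout.Identity.+- x y 1+yN≡xt =
    ∙∈⇒∈ (multiples N) (resp (multiples N) xt·z≈z∙yN·z (·∈ (multiples N) x tz∈NG)) (multiple-divisible y N z)
    where
    xt·z≈z∙yN·z : x · (t · z) ≈ z ∙ (y * N) · z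
    xt·z≈z∙yN·z = trans (·-* x t z) (≡.subst (λ k → k · z ≈ z ∙ (y * N) · z) 1+yN≡xt refl)
  ... | Bézout.Identity.-+ x y 1+xt≡yN =
    ∙∈⇒∈ (multiples N) (≡.subst (λ k → Divisible N (k · z)) (≡.sym 1+xt≡yN) (multiple-divisible y N z))
      (resp (multiples N) (·-* x t z) (·∈ (multiples N) x tz∈NG))

  ⟨_⟩ : Carrier → Subgroup G
  ⟨ b ⟩ = record
    { _∈S = λ x → Lift c (∃[ m ] x ≈ m ⋆ b)
    ; resp = λ { x≈y (lift (m , x≈mb)) → lift (m , trans (sym x≈y) x≈mb) }
    ; ε∈ = lift (+ 0 , refl)
    ; ∙∈ = λ { (lift (m , x≈mb)) (lift (n , y≈nb)) →
               lift (m ℤ.+ n , trans (∙-cong x≈mb y≈nb) (sym (⋆-+ m n b))) }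
    ; ⁻¹∈ = λ { (lift (m , x≈mb)) → lift (ℤ.- m , trans (⁻¹-cong x≈mb) (sym (⋆-neg m b))) }
    }

  RationalMultiple : Carrier → Carrier → Set (c ⊔ ℓ)
  RationalMultiple x b = ∃[ n ] n ≢ 0 × (⟨ b ⟩ ∈S) (n · x)

  ⋆-rationalMultiple : ∀ {i j x b} → i ≢ + 0 → i ⋆ x ≈ j ⋆ b → RationalMultiple x b
  ⋆-rationalMultiple {+ n} {j} i≢0 nx≈jb = n , (λ n≡0 → i≢0 (≡.cong +_ n≡0)) , lift (j , nx≈jb)
  ⋆-rationalMultiple { -[1+ n ]} {j} {x} {b} _ nx⁻¹≈jb = suc n , (λ ()) , lift (ℤ.- j , nx≈-jb)
    where
    nx≈-jb : suc n · x ≈ (ℤ.- j) ⋆ b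
    nx≈-jb = trans (sym (⁻¹-involutive _)) (trans (⁻¹-cong nx⁻¹≈jb) (sym (⋆-neg j b)))

  lincomb-zero-head : ∀ k cs vs → cs Fin.zero ≡ + 0 → lincomb G (suc k) cs vs ≈ lincomb G k (tail cs) (tail vs)
  lincomb-zero-head k cs vs c₀≡0 =
    trans (∙-congʳ (≡.subst (λ i → i ⋆ vs Fin.zero ≈ ε) (≡.sym c₀≡0) refl)) (identityˡ _)

  trivial-relation : ∀ k cs vs → Independent G k (tail vs) → lincomb G (suc k) cs vs ≈ ε →
                     cs Fin.zero ≡ + 0 → ∀ i → cs i ≡ + 0
  trivial-relation k cs vs ind rel c₀≡0 Fin.zero = c₀≡0
  trivial-relation k cs vs ind rel c₀≡0 (Fin.suc i) =
    ind (tail cs) (trans (sym (lincomb-zero-head k cs vs c₀≡0)) rel) i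

  nontrivial-on-pair : ∀ k cs x z vs → Independent G k vs → lincomb G (suc (suc k)) cs (x ∷ z ∷ vs) ≈ ε →
                       ∃[ i ] cs i ≢ + 0 → ∃[ j ] (cs Fin.zero ∷ cs (Fin.suc Fin.zero) ∷ []) j ≢ + 0
  nontrivial-on-pair k cs x z vs ind rel (i , cᵢ≢0) with cs Fin.zero ℤ.≟ + 0 | cs (Fin.suc Fin.zero) ℤ.≟ + 0
  ... | no c₀≢0 | _ = Fin.zero , c₀≢0
  ... | yes _ | no c₁≢0 = Fin.suc Fin.zero , c₁≢0
  ... | yes c₀≡0 | yes c₁≡0 = contradiction (all-zero i) cᵢ≢0
    where
    all-zero : ∀ j → cs j ≡ + 0
    all-zero Fin.zero = c₀≡0
    all-zero (Fin.suc j) = trivial-relation k (tail cs) (z ∷ vs) ind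
      (trans (sym (lincomb-zero-head (suc k) cs (x ∷ z ∷ vs) c₀≡0)) rel) c₁≡0 j

  height-zero : ∀ x p → Height x p 0
  height-zero x p = x , sym (identityʳ x)

  ∣∣-divisible : ∀ {N} i x → Divisible N (i ⋆ x) → Divisible N (∣ i ∣ · x)
  ∣∣-divisible (+ n) x N∣nx = N∣nx
  ∣∣-divisible {N} -[1+ n ] x N∣nx⁻¹ = resp (multiples N) (⁻¹-involutive _) (⁻¹∈ (multiples N) N∣nx⁻¹)

  uniform-rationalMultiple : ∀ {b} k (bs : Fin k → Carrier) → (∀ i → RationalMultiple (bs i) b) →
                             ∃[ M ] M ≢ 0 × (∀ cs → (⟨ b ⟩ ∈S) (M · lincomb G k cs bs))
  uniform-rationalMultiple {b} k bs bs∈ℚb with common-multiple ⟨ b ⟩ k bs bs∈ℚb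
  ... | M , M≢0 , Mbs∈ℤb = M , M≢0 , λ cs → lincomb∈ (·-preimage ⟨ b ⟩ M) k cs bs Mbs∈ℤb

  module TorsionFreeGroup (tf : TorsionFree G) where

    ·-cancel : ∀ n {x y} → n ≢ 0 → n · x ≈ n · y → x ≈ y
    ·-cancel zero n≢0 _ = contradiction ≡.refl n≢0
    ·-cancel (suc n) {x} {y} _ nx≈ny = x∙y⁻¹≈ε⇒x≈y x y (tf n _ n[x∙y⁻¹]≈ε)
      where
      n[x∙y⁻¹]≈ε : suc n · (x ∙ y ⁻¹) ≈ ε
      n[x∙y⁻¹]≈ε = begin
        suc n · (x ∙ y ⁻¹)               ≈⟨ ·-∙ (suc n) x (y ⁻¹) ⟩
        suc n · x ∙ suc n · (y ⁻¹)       ≈⟨ ∙-congˡ (·-⁻¹ (suc n) y) ⟩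
        suc n · x ∙ (suc n · y) ⁻¹       ≈⟨ x≈y⇒x∙y⁻¹≈ε nx≈ny ⟩
        ε                                ∎

    ⋆-torsionFree : ∀ {i x} → i ≢ + 0 → i ⋆ x ≈ ε → x ≈ ε
    ⋆-torsionFree {+ n} i≢0 nx≈ε = ·-cancel n (λ n≡0 → i≢0 (≡.cong +_ n≡0)) (trans nx≈ε (sym (·-ε n)))
    ⋆-torsionFree { -[1+ n ]} _ nx⁻¹≈ε =
      tf n _ (trans (sym (⁻¹-involutive _)) (trans (⁻¹-cong nx⁻¹≈ε) ε⁻¹≈ε))

    ⋆-cancel : ∀ {i j x} → ¬ x ≈ ε → i ⋆ x ≈ j ⋆ x → i ≡ j
    ⋆-cancel {i} {j} {x} x≉ε ix≈jx with i ℤ.- j ℤ.≟ + 0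
    ... | yes i-j≡0 = ℤ.i-j≡0⇒i≡j i j i-j≡0
    ... | no i-j≢0 = contradiction (⋆-torsionFree i-j≢0 [i-j]x≈ε) x≉ε
      where
      [i-j]x≈ε : (i ℤ.- j) ⋆ x ≈ ε
      [i-j]x≈ε = begin
        (i ℤ.- j) ⋆ x           ≈⟨ ⋆-+ i (ℤ.- j) x ⟩
        i ⋆ x ∙ (ℤ.- j) ⋆ x     ≈⟨ ∙-congˡ (⋆-neg j x) ⟩
        i ⋆ x ∙ (j ⋆ x) ⁻¹      ≈⟨ x≈y⇒x∙y⁻¹≈ε ix≈jx ⟩
        ε                       ∎

    divisible-cancel : ∀ {d N x} → d ≢ 0 → Divisible (d * N) (d · x) → Divisible N x
    divisible-cancel {d} {N} d≢0 (y , dx≈dNy) = y , ·-cancel d d≢0 (trans dx≈dNy (sym (·-* d N y)))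

    -- Induction on e: if p ∤ n use Bézout, otherwise cancel one factor p from n and from p ^ (k + e).
    divisible-of-multiple : ∀ {p} → Prime p → ∀ e n → p ^ suc e ∤ n → ∀ k z →
                            Divisible (p ^ (k + e)) (n · z) → Divisible (p ^ k) z
    divisible-of-multiple {p} pp e n p^e+1∤n k z p^K∣nz with p ∣? n
    ... | no p∤n = divisible-∣ p^k∣p^K (divisible-coprime (coprime-^ pp p∤n (k + e)) p^K∣nz)
      where
      p^k∣p^K : p ^ k ∣ p ^ (k + e)
      p^k∣p^K = ≡.subst (p ^ k ∣_) (≡.sym (ℕ.^-distribˡ-+-* p k e)) (m∣m*n (p ^ e))
    divisible-of-multiple {p} pp zero .(n' * p) p∤n k z _ | yes (divides n' ≡.refl) =
      contradiction (divides n' (≡.cong (n' *_) (≡.sym (ℕ.*-identityʳ p)))) p∤n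
    divisible-of-multiple {p} pp (suc e) .(n' * p) p^e+2∤n'p k z p^K∣n'pz
      | yes (divides n' ≡.refl) =
      divisible-of-multiple pp e n' p^e+1∤n' k z
        (divisible-cancel {N = p ^ (k + e)} (ℕ.≢-nonZero⁻¹ p ⦃ prime⇒nonZero pp ⦄)
          (resp (multiples (p * p ^ (k + e))) (*-· n' p z) p^K'∣n'pz))
      where
      p^e+1∤n' : p ^ suc e ∤ n'
      p^e+1∤n' p^e+1∣n' = p^e+2∤n'p (≡.subst (_∣ n' * p) (ℕ.*-comm (p ^ suc e) p) (*-monoˡ-∣ p p^e+1∣n'))
      p^K'∣n'pz : Divisible (p * p ^ (k + e)) ((n' * p) · z)
      p^K'∣n'pz = ≡.subst (λ m → Divisible (p ^ m) ((n' * p) · z)) (ℕ.+-suc k e) p^K∣n'pz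

    dominates : ∀ {n m x z} → n · z ≈ m ⋆ x → Dominates n (Height x) (Height z)
    dominates {n} {m} {x} {z} nz≈mx p pp e p^e+1∤n k (u , x≈p^Ku) =
      divisible-of-multiple pp e n p^e+1∤n k z (m ⋆ u , nz≈p^K[mu])
      where
      nz≈p^K[mu] : n · z ≈ (p ^ (k + e)) · (m ⋆ u)
      nz≈p^K[mu] = trans nz≈mx (trans (⋆-cong m x≈p^Ku) (⋆-·-comm m (p ^ (k + e)) u))

    dependent₂⇒rationalMultiple : ∀ {x z} → ¬ z ≈ ε → Dependent G 2 (x ∷ z ∷ []) → RationalMultiple x z
    dependent₂⇒rationalMultiple {x} {z} z≉ε (cs , rel , i , cᵢ≢0) =
      ⋆-rationalMultiple {j = ℤ.- n} (m≢0 i cᵢ≢0) mx≈[-n]z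
      where
      m n : ℤ
      m = cs Fin.zero
      n = cs (Fin.suc Fin.zero)
      mx≈[-n]z : m ⋆ x ≈ (ℤ.- n) ⋆ z
      mx≈[-n]z = begin
        m ⋆ x            ≈⟨ inverseˡ-unique _ _ rel ⟩
        (n ⋆ z ∙ ε) ⁻¹   ≈⟨ ⁻¹-cong (identityʳ _) ⟩
        (n ⋆ z) ⁻¹       ≈⟨ ⋆-neg n z ⟨
        (ℤ.- n) ⋆ z      ∎
      nz≈ε : m ≡ + 0 → n ⋆ z ≈ ε
      nz≈ε m≡0 = begin
        n ⋆ z                ≈⟨ ⁻¹-involutive _ ⟨
        ((n ⋆ z) ⁻¹) ⁻¹      ≈⟨ ⁻¹-cong (trans (sym (⋆-neg n z)) (sym mx≈[-n]z)) ⟩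
        (m ⋆ x) ⁻¹           ≡⟨ ≡.cong (λ j → (j ⋆ x) ⁻¹) m≡0 ⟩
        ε ⁻¹                 ≈⟨ ε⁻¹≈ε ⟩
        ε                    ∎
      m≢0 : ∀ j → cs j ≢ + 0 → m ≢ + 0
      m≢0 Fin.zero c₀≢0 = c₀≢0
      m≢0 (Fin.suc Fin.zero) n≢0 m≡0 = z≉ε (⋆-torsionFree n≢0 (nz≈ε m≡0))

    ≈ε? : ∀ {x z} → ¬ z ≈ ε → RationalMultiple x z → Dec (x ≈ ε)
    ≈ε? {x} {z} z≉ε (n , n≢0 , lift (m , nx≈mz)) with m ℤ.≟ + 0
    ... | yes m≡0 = yes (·-cancel n n≢0 (trans nx≈mz (trans mz≈ε (sym (·-ε n)))))
      where
      mz≈ε : m ⋆ z ≈ ε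
      mz≈ε = ≡.subst (λ j → j ⋆ z ≈ ε) (≡.sym m≡0) refl
    ... | no m≢0 = no λ x≈ε → z≉ε (⋆-torsionFree m≢0 (trans (sym nx≈mz) (trans (·-cong n x≈ε) (·-ε n))))

    heights-charEquiv : ∀ {x z} → RationalMultiple x z → RationalMultiple z x → CharEquiv (Height x) (Height z)
    heights-charEquiv (n , n≢0 , lift (m , nx≈mz)) (n' , n'≢0 , lift (m' , n'z≈m'x)) =
      dominates⇒charEquiv n'≢0 n≢0 (dominates {m = m'} n'z≈m'x) (dominates {m = m} nx≈mz)

module QuotientGroup {c ℓ : Level} (A : AbelianGroup c ℓ) (S : Subgroup A) where
  open AbelianGroup A
  open import Algebra.Properties.AbelianGroup A
  open import Algebra.Properties.CommutativeSemigroup commutativeSemigroup using (interchange)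
  open Multiples A using (_·_; _⋆_)

  infix 4 _≋_
  _≋_ : Carrier → Carrier → Set (c ⊔ ℓ)
  x ≋ y = (S ∈S) (x ∙ y ⁻¹)

  ≈⇒≋ : ∀ {x y} → x ≈ y → x ≋ y
  ≈⇒≋ x≈y = resp S (sym (x≈y⇒x∙y⁻¹≈ε x≈y)) (ε∈ S)

  ≋-sym : ∀ {x y} → x ≋ y → y ≋ x
  ≋-sym {x} {y} x≋y = resp S (⁻¹-anti-homo‿- x y) (⁻¹∈ S x≋y)

  ≋-trans : ∀ {x y z} → x ≋ y → y ≋ z → x ≋ z
  ≋-trans {x} {y} {z} x≋y y≋z = resp S x-y+y-z≈x-z (∙∈ S x≋y y≋z)
    where
    x-y+y-z≈x-z : (x ∙ y ⁻¹) ∙ (y ∙ z ⁻¹) ≈ x ∙ z ⁻¹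
    x-y+y-z≈x-z = trans (assoc _ _ _) (∙-congˡ (trans (sym (assoc _ _ _))
      (trans (∙-congʳ (inverseˡ y)) (identityˡ _))))

  ≋-∙-cong : ∀ {x y u v} → x ≋ y → u ≋ v → (x ∙ u) ≋ (y ∙ v)
  ≋-∙-cong {x} {y} {u} {v} x≋y u≋v = resp S (sym xu-yv≈x-y+u-v) (∙∈ S x≋y u≋v)
    where
    xu-yv≈x-y+u-v : (x ∙ u) ∙ (y ∙ v) ⁻¹ ≈ (x ∙ y ⁻¹) ∙ (u ∙ v ⁻¹)
    xu-yv≈x-y+u-v = trans (∙-congˡ (sym (⁻¹-∙-comm y v))) (interchange x u (y ⁻¹) (v ⁻¹))

  ≋-⁻¹-cong : ∀ {x y} → x ≋ y → x ⁻¹ ≋ y ⁻¹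
  ≋-⁻¹-cong {x} {y} x≋y = resp S (sym (⁻¹-∙-comm x (y ⁻¹))) (⁻¹∈ S x≋y)

  quotient : AbelianGroup c (c ⊔ ℓ)
  quotient = record
    { Carrier = Carrier
    ; _≈_ = _≋_
    ; _∙_ = _∙_
    ; ε = ε
    ; _⁻¹ = _⁻¹
    ; isAbelianGroup = record
      { isGroup = record
        { isMonoid = record
          { isSemigroup = record
            { isMagma = record
              { isEquivalence = record { refl = ≈⇒≋ refl ; sym = ≋-sym ; trans = ≋-trans }
              ; ∙-cong = ≋-∙-cong
              }
            ; assoc = λ x y z → ≈⇒≋ (assoc x y z)
            }
          ; identity = (λ x → ≈⇒≋ (identityˡ x)) , (λ x → ≈⇒≋ (identityʳ x))
          }
        ; inverse = (λ x → ≈⇒≋ (inverseˡ x)) , (λ x → ≈⇒≋ (inverseʳ x))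
        ; ⁻¹-cong = ≋-⁻¹-cong
        }
      ; comm = λ x y → ≈⇒≋ (comm x y)
      }
    }

  -- Multiples in A / S are those of A, but only up to ≡: they are computed from another bundle.
  ·/≡· : ∀ n x → _·ℕ_ quotient n x ≡ n · x
  ·/≡· zero x = ≡.refl
  ·/≡· (suc n) x = ≡.cong (x ∙_) (·/≡· n x)

  ⋆/≡⋆ : ∀ i x → _·ℤ_ quotient i x ≡ i ⋆ x
  ⋆/≡⋆ (+ n) x = ·/≡· n x
  ⋆/≡⋆ -[1+ n ] x = ≡.cong _⁻¹ (·/≡· (suc n) x)

  lincomb/≡lincomb : ∀ k cs vs → lincomb quotient k cs vs ≡ lincomb A k cs vs
  lincomb/≡lincomb zero cs vs = ≡.refl
  lincomb/≡lincomb (suc k) cs vs =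
    ≡.cong₂ _∙_ (⋆/≡⋆ (cs Fin.zero) (vs Fin.zero)) (lincomb/≡lincomb k (tail cs) (tail vs))

  ∈⇒≋ε : ∀ {x} → (S ∈S) x → x ≋ ε
  ∈⇒≋ε {x} = resp S (sym (trans (∙-congˡ ε⁻¹≈ε) (identityʳ x)))

  ≋ε⇒∈ : ∀ {x} → x ≋ ε → (S ∈S) x
  ≋ε⇒∈ {x} = resp S (trans (∙-congˡ ε⁻¹≈ε) (identityʳ x))

  torsionFree : TorsionFree A → Pure A S → TorsionFree quotient
  torsionFree tf pure n a na≋ε with pure (suc n) (suc n · a) na∈S (a , refl)
    where
    na∈S : (S ∈S) (suc n · a)
    na∈S = ≋ε⇒∈ (≡.subst (_≋ ε) (·/≡· (suc n) a) na≋ε)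
  ... | b , b∈S , nb≈na = ∈⇒≋ε (resp S b≈a b∈S)
    where
    b≈a : b ≈ a
    b≈a = Multiples.TorsionFreeGroup.·-cancel A tf (suc n) (λ ()) nb≈na

  height⇔ : ∀ x p k → QuotHeightGE A S x p k ⇔ Multiples.Height quotient x p k
  height⇔ x p k = mk⇔
    (λ { (y , x≋p^ky) → y , ≡.subst (x ≋_) (≡.sym (·/≡· (p ^ k) y)) x≋p^ky })
    (λ { (y , x≋p^ky) → y , ≡.subst (x ≋_) (·/≡· (p ^ k) y) x≋p^ky })

_/_ : {c ℓ : Level} (A : AbelianGroup c ℓ) → Subgroup A → AbelianGroup c (c ⊔ ℓ)
A / S = QuotientGroup.quotient A S

quotHeight-charEquiv : {c ℓ : Level} {A : AbelianGroup c ℓ} (B C : Subgroup A) {x y : AbelianGroup.Carrier A} →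
  CharEquiv (Multiples.Height (A / B) x) (Multiples.Height (A / C) y) → CharEquiv (QuotHeightGE A B x) (QuotHeightGE A C y)
quotHeight-charEquiv {A = A} B C {x} {y} x~y =
  charEquiv-trans (⇔⇒charEquiv (QuotientGroup.height⇔ A B x))
    (charEquiv-trans x~y (⇔⇒charEquiv (λ p k → ⇔-sym (QuotientGroup.height⇔ A C y p k))))

module PureOfCorankOne {c ℓ : Level} {A : AbelianGroup c ℓ} {r : ℕ}
  (tf : TorsionFree A) (dependent : ∀ vs → Dependent A (suc (suc r)) vs)
  (S : Subgroup A) (pure : Pure A S)
  (ws : Fin r → AbelianGroup.Carrier A) (ws∈S : ∀ i → (S ∈S) (ws i)) (independent : Independent A r ws) where

  open AbelianGroup A using (Carrier; ε; _∙_)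
  open QuotientGroup A S
  open Multiples A using (_⋆_; lincomb∈; nontrivial-on-pair)
  module A/S = AbelianGroup (A / S)
  open Multiples (A / S) using (RationalMultiple)

  torsionFree/ : TorsionFree (A / S)
  torsionFree/ = torsionFree tf pure

  open Multiples.TorsionFreeGroup (A / S) torsionFree/
  open import Relation.Binary.Reasoning.Setoid A/S.setoid

  dependent₂ : ∀ x z → Dependent (A / S) 2 (x ∷ z ∷ [])
  dependent₂ x z with dependent (x ∷ z ∷ ws)
  ... | cs , rel , nontrivial = m ∷ n ∷ [] , rel₂ , nontrivial-on-pair r cs x z ws independent rel nontrivial
    where
    m n : ℤ
    m = cs Fin.zero
    n = cs (Fin.suc Fin.zero)
    L : Carrier
    L = lincomb A r (tail (tail cs)) ws
    rel₂ : lincomb (A / S) 2 (m ∷ n ∷ []) (x ∷ z ∷ []) ≋ ε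
    rel₂ = begin
      lincomb (A / S) 2 (m ∷ n ∷ []) (x ∷ z ∷ [])   ≡⟨ lincomb/≡lincomb 2 (m ∷ n ∷ []) (x ∷ z ∷ []) ⟩
      m ⋆ x ∙ (n ⋆ z ∙ ε)                           ≈⟨ A/S.∙-congˡ (A/S.∙-congˡ (≋-sym (∈⇒≋ε L∈S))) ⟩
      m ⋆ x ∙ (n ⋆ z ∙ L)                           ≈⟨ ≈⇒≋ rel ⟩
      ε                                             ∎
      where
      L∈S : (S ∈S) L
      L∈S = lincomb∈ S r _ ws ws∈S

  rationalMultiple : ∀ {z} → ¬ (S ∈S) z → ∀ x → RationalMultiple x z
  rationalMultiple {z} z∉S x = dependent₂⇒rationalMultiple (λ z≋ε → z∉S (≋ε⇒∈ z≋ε)) (dependent₂ x z)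

  ∈? : ∀ {z} → ¬ (S ∈S) z → ∀ x → Dec ((S ∈S) x)
  ∈? z∉S x with ≈ε? (λ z≋ε → z∉S (≋ε⇒∈ z≋ε)) (rationalMultiple z∉S x)
  ... | yes x≋ε = yes (≋ε⇒∈ x≋ε)
  ... | no x≉ε = no λ x∈S → x≉ε (∈⇒≋ε x∈S)

  nonzero-charEquiv : ∀ {x z} → ¬ (S ∈S) x → ¬ (S ∈S) z → CharEquiv (QuotHeightGE A S x) (QuotHeightGE A S z)
  nonzero-charEquiv x∉S z∉S =
    quotHeight-charEquiv S S (heights-charEquiv (rationalMultiple z∉S _) (rationalMultiple x∉S _))

module _ {c ℓ : Level} {A : AbelianGroup c ℓ} where
  open AbelianGroup A using (Carrier; ε; sym)
  open import Algebra.Properties.AbelianGroup A using (inverseˡ-unique)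
  open Multiples A using (_⋆_; lincomb∈; trivial-relation)

  shared-independent⇒⊆ : ∀ {r} (S T : Subgroup A) → TorsionFree (A / T) →
    (∀ vs → (∀ i → (S ∈S) (vs i)) → Dependent A (suc r) vs) →
    (ws : Fin r → Carrier) → Independent A r ws → (∀ i → (S ∈S) (ws i)) → (∀ i → (T ∈S) (ws i)) →
    ∀ z → (S ∈S) z → (T ∈S) z
  shared-independent⇒⊆ {r} S T tfT dependentS ws independent ws∈S ws∈T z z∈S
    with dependentS (z ∷ ws) (λ { Fin.zero → z∈S ; (Fin.suc i) → ws∈S i })
  ... | cs , rel , i , cᵢ≢0 = ≋ε⇒∈ (⋆-torsionFree d≢0 dz≋ε)
    where
    open QuotientGroup A T using (_≋_; ∈⇒≋ε; ≋ε⇒∈; ⋆/≡⋆)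
    open Multiples.TorsionFreeGroup (A / T) tfT using (⋆-torsionFree)
    d : ℤ
    d = cs Fin.zero
    d≢0 : d ≢ + 0
    d≢0 d≡0 = cᵢ≢0 (trivial-relation r cs (z ∷ ws) independent rel d≡0 i)
    dz∈T : (T ∈S) (d ⋆ z)
    dz∈T = resp T (sym (inverseˡ-unique _ _ rel)) (⁻¹∈ T (lincomb∈ T r (tail cs) ws ws∈T))
    dz≋ε : _·ℤ_ (A / T) d z ≋ ε
    dz≋ε = ≡.subst (_≋ ε) (≡.sym (⋆/≡⋆ d z)) (∈⇒≋ε dz∈T)

  equal-or-crossing : ∀ {r} (B C : Subgroup A) → TorsionFree (A / B) → TorsionFree (A / C) →
    HasRankSub A B r → HasRankSub A C r → (∀ x → Dec ((B ∈S) x)) → (∀ x → Dec ((C ∈S) x)) →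
    (∀ z → (B ∈S) z ⇔ (C ∈S) z) ⊎ ((∃[ b ] (B ∈S) b × ¬ (C ∈S) b) × (∃[ c ] (C ∈S) c × ¬ (B ∈S) c))
  equal-or-crossing {r} B C tfB tfC ((vs , vs∈B , vs-ind) , depB) ((ws , ws∈C , ws-ind) , depC) B? C?
    with all? (λ i → C? (vs i))
  ... | yes vs∈C = inj₁ λ z → mk⇔
    (shared-independent⇒⊆ B C tfC depB vs vs-ind vs∈B vs∈C z)
    (shared-independent⇒⊆ C B tfB depC vs vs-ind vs∈C vs∈B z)
  ... | no vs⊈C with ¬∀⟶∃¬ r _ (λ i → C? (vs i)) vs⊈C | all? (λ j → B? (ws j))
  ...   | i , vsᵢ∉C | yes ws∈B =
    contradiction (shared-independent⇒⊆ B C tfC depB ws ws-ind ws∈B ws∈C (vs i) (vs∈B i)) vsᵢ∉C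
  ...   | i , vsᵢ∉C | no ws⊈B with ¬∀⟶∃¬ r _ (λ j → B? (ws j)) ws⊈B
  ...     | j , wsⱼ∉B = inj₂ ((vs i , vs∈B i , vsᵢ∉C) , (ws j , ws∈C j , wsⱼ∉B))

-- In A / C the subgroup ⟨ b ⟩ is ℤ b + C, so the hypotheses say M' B ⊆ ℤ b + C and M C ⊆ ℤ c + B.
module Crossing {c ℓ : Level} {A : AbelianGroup c ℓ} (B C : Subgroup A)
  (tfB : TorsionFree (A / B)) (tfC : TorsionFree (A / C))
  {b c : AbelianGroup.Carrier A} (b∈B : (B ∈S) b) (c∈C : (C ∈S) c) (c∉B : ¬ (B ∈S) c)
  {M M' : ℕ}
  (M'B⊆ℤb : ∀ β → (B ∈S) β → (Multiples.⟨_⟩ (A / C) b ∈S) (_·ℕ_ (A / C) M' β))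
  (MC⊆ℤc : ∀ γ → (C ∈S) γ → (Multiples.⟨_⟩ (A / B) c ∈S) (_·ℕ_ (A / B) M γ)) where

  open AbelianGroup A using (ε; _∙_; _⁻¹)
  module /B = QuotientGroup A B
  module /C = QuotientGroup A C
  module ᴮ = Multiples (A / B)
  module ᶜ = Multiples (A / C)
  module A/B = AbelianGroup (A / B)
  module A/C = AbelianGroup (A / C)
  open /B using (_≋_)
  open /C using () renaming (_≋_ to _≋ᶜ_)
  open ᴮ using (_·_; _⋆_)
  open ᶜ using () renaming (_·_ to _·ᶜ_; _⋆_ to _⋆ᶜ_)

  divisor-bound : ∀ {γ d m} → (C ∈S) γ → d · γ ≋ m · c → d ∣ M * m
  divisor-bound {γ} {d} {m} γ∈C dγ≋mc with lower (MC⊆ℤc γ γ∈C)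
  ... | s , Mγ≋sc =
    divides ∣ s ∣ (≡.trans (≡.cong ∣_∣ Mm≡ds) (≡.trans (ℤ.abs-* (+ d) s) (ℕ.*-comm d ∣ s ∣)))
    where
    open import Relation.Binary.Reasoning.Setoid A/B.setoid
    Mm·c≋ds·c : (M * m) · c ≋ (+ d ℤ.* s) ⋆ c
    Mm·c≋ds·c = begin
      (M * m) · c     ≈⟨ ᴮ.·-* M m c ⟨
      M · (m · c)     ≈⟨ ᴮ.·-cong M dγ≋mc ⟨
      M · (d · γ)     ≈⟨ ᴮ.·-comm M d γ ⟩
      d · (M · γ)     ≈⟨ ᴮ.·-cong d Mγ≋sc ⟩
      d · (s ⋆ c)     ≈⟨ ᴮ.·-⋆ d s c ⟩
      (+ d ℤ.* s) ⋆ c ∎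
    Mm≡ds : + (M * m) ≡ + d ℤ.* s
    Mm≡ds = Multiples.TorsionFreeGroup.⋆-cancel (A / B) tfB (λ c≋ε → c∉B (/B.≋ε⇒∈ c≋ε)) Mm·c≋ds·c

  ·≡·ᶜ : ∀ n x → n · x ≡ n ·ᶜ x
  ·≡·ᶜ n x = ≡.trans (/B.·/≡· n x) (≡.sym (/C.·/≡· n x))

  ⋆ᶜ≡⋆ : ∀ i x → i ⋆ᶜ x ≡ i ⋆ x
  ⋆ᶜ≡⋆ i x = ≡.trans (/C.⋆/≡⋆ i x) (≡.sym (/B.⋆/≡⋆ i x))

  -- γ = q M' a − n₀ b lies in C by purity, and d γ ≡ M' c (mod B).
  common-divisor-bound : ∀ {N a n d q} → c ≋ N · a → n ⋆ᶜ b ≋ᶜ N ·ᶜ (M' ·ᶜ a) →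
                         N ≡ d * q → (+ d) ∣ℤ n → d ≢ 0 → d ∣ M * M'
  common-divisor-bound {N} {a} {n} {d} {q} c≋Na nb≋N[M'a] N≡dq (ℤ∣.divides n₀ n≡n₀d) d≢0 =
    divisor-bound (/C.≋-sym n₀b≋q[M'a]) dγ≋M'c
    where
    n₀b≋q[M'a] : n₀ ⋆ᶜ b ≋ᶜ q ·ᶜ (M' ·ᶜ a)
    n₀b≋q[M'a] = Multiples.TorsionFreeGroup.·-cancel (A / C) tfC d d≢0 (begin
      d ·ᶜ (n₀ ⋆ᶜ b)         ≈⟨ ᶜ.·-⋆ d n₀ b ⟩
      (+ d ℤ.* n₀) ⋆ᶜ b      ≡⟨ ≡.cong (_⋆ᶜ b) (≡.trans (ℤ.*-comm (+ d) n₀) (≡.sym n≡n₀d)) ⟩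
      n ⋆ᶜ b                 ≈⟨ nb≋N[M'a] ⟩
      N ·ᶜ (M' ·ᶜ a)         ≡⟨ ≡.cong (_·ᶜ (M' ·ᶜ a)) N≡dq ⟩
      (d * q) ·ᶜ (M' ·ᶜ a)   ≈⟨ ᶜ.·-* d q _ ⟨
      d ·ᶜ (q ·ᶜ (M' ·ᶜ a))  ∎)
      where open import Relation.Binary.Reasoning.Setoid A/C.setoid
    γ≡ : q ·ᶜ (M' ·ᶜ a) ∙ (n₀ ⋆ᶜ b) ⁻¹ ≡ q · (M' · a) ∙ (n₀ ⋆ b) ⁻¹
    γ≡ = ≡.cong₂ (λ u v → u ∙ v ⁻¹)
      (≡.trans (≡.cong (q ·ᶜ_) (≡.sym (·≡·ᶜ M' a))) (≡.sym (·≡·ᶜ q _))) (⋆ᶜ≡⋆ n₀ b)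
    n₀b⁻¹≋ε : (n₀ ⋆ b) ⁻¹ ≋ ε
    n₀b⁻¹≋ε = A/B.trans (A/B.sym (ᴮ.⋆-neg n₀ b))
      (A/B.trans (ᴮ.⋆-cong (ℤ.- n₀) (/B.∈⇒≋ε b∈B)) (ᴮ.⋆-ε (ℤ.- n₀)))
    dγ≋M'c : d · (q ·ᶜ (M' ·ᶜ a) ∙ (n₀ ⋆ᶜ b) ⁻¹) ≋ M' · c
    dγ≋M'c = begin
      d · (q ·ᶜ (M' ·ᶜ a) ∙ (n₀ ⋆ᶜ b) ⁻¹)  ≡⟨ ≡.cong (d ·_) γ≡ ⟩
      d · (q · (M' · a) ∙ (n₀ ⋆ b) ⁻¹)    ≈⟨ ᴮ.·-cong d (A/B.∙-congˡ n₀b⁻¹≋ε) ⟩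
      d · (q · (M' · a) ∙ ε)              ≈⟨ ᴮ.·-cong d (A/B.identityʳ _) ⟩
      d · (q · (M' · a))                  ≈⟨ ᴮ.·-* d q _ ⟩
      (d * q) · (M' · a)                  ≡⟨ ≡.cong (_· (M' · a)) N≡dq ⟨
      N · (M' · a)                        ≈⟨ ᴮ.·-comm N M' a ⟩
      M' · (N · a)                        ≈⟨ ᴮ.·-cong M' c≋Na ⟨
      M' · c                              ∎
      where open import Relation.Binary.Reasoning.Setoid A/B.setoid

  nb≋N[M'a] : ∀ {N a n} → M' ·ᶜ (N · a ∙ c ⁻¹) ≋ᶜ n ⋆ᶜ b → n ⋆ᶜ b ≋ᶜ N ·ᶜ (M' ·ᶜ a)
  nb≋N[M'a] {N} {a} {n} M'β≋nb = begin
    n ⋆ᶜ b                    ≈⟨ M'β≋nb ⟨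
    M' ·ᶜ (N · a ∙ c ⁻¹)      ≡⟨ ≡.cong (λ u → M' ·ᶜ (u ∙ c ⁻¹)) (·≡·ᶜ N a) ⟩
    M' ·ᶜ (N ·ᶜ a ∙ c ⁻¹)     ≈⟨ ᶜ.·-cong M' (A/C.∙-congˡ (/C.∈⇒≋ε (⁻¹∈ C c∈C))) ⟩
    M' ·ᶜ (N ·ᶜ a ∙ ε)        ≈⟨ ᶜ.·-cong M' (A/C.identityʳ _) ⟩
    M' ·ᶜ (N ·ᶜ a)            ≈⟨ ᶜ.·-comm M' N a ⟩
    N ·ᶜ (M' ·ᶜ a)            ∎
    where open import Relation.Binary.Reasoning.Setoid A/C.setoid

  height-of-b : ∀ {p} → Prime p → ∀ e → p ^ suc e ∤ M * M' → ∀ k {a n} →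
                c ≋ (p ^ (k + e)) · a → n ⋆ᶜ b ≋ᶜ (p ^ (k + e)) ·ᶜ (M' ·ᶜ a) → ᶜ.Height b p k
  height-of-b {p} pp e p^e+1∤MM' zero _ _ = ᶜ.height-zero b p
  height-of-b {p} pp e p^e+1∤MM' (suc k) {a} {n} c≋p^Ka nb≋p^K[M'a] with p ^ suc e ∣? ∣ n ∣
  ... | no p^e+1∤n = Multiples.TorsionFreeGroup.divisible-of-multiple (A / C) tfC pp e ∣ n ∣ p^e+1∤n (suc k) b
    (ᶜ.∣∣-divisible {p ^ (suc k + e)} n b (M' ·ᶜ a , nb≋p^K[M'a]))
  ... | yes p^e+1∣n = contradiction
    (common-divisor-bound {p ^ (suc k + e)} {a} {n} {p ^ suc e} {p ^ k}
      c≋p^Ka nb≋p^K[M'a] p^K≡p^e+1*p^k (∣ᵤ⇒∣ p^e+1∣n) p^e+1≢0)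
    p^e+1∤MM'
    where
    p^K≡p^e+1*p^k : p ^ (suc k + e) ≡ p ^ suc e * p ^ k
    p^K≡p^e+1*p^k = ≡.trans (≡.cong (λ m → p ^ suc m) (ℕ.+-comm k e)) (ℕ.^-distribˡ-+-* p (suc e) k)
    p^e+1≢0 : p ^ suc e ≢ 0
    p^e+1≢0 p^e+1≡0 = ℕ.≢-nonZero⁻¹ p ⦃ prime⇒nonZero pp ⦄ (ℕ.m^n≡0⇒m≡0 p (suc e) p^e+1≡0)

  crossing-dominates : Dominates (M * M') (ᴮ.Height c) (ᶜ.Height b)
  crossing-dominates p pp e p^e+1∤MM' k (a , c≋p^Ka) with lower (M'B⊆ℤb _ (/B.≋-sym c≋p^Ka))
  ... | n , M'β≋nb = height-of-b pp e p^e+1∤MM' k {a} {n} c≋p^Ka (nb≋N[M'a] {p ^ (k + e)} {a} {n} M'β≋nb)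

module _ {c ℓ : Level} {A : AbelianGroup c ℓ} (S T : Subgroup A) where
  open Multiples (A / T) using (RationalMultiple; ⟨_⟩; _·_; ·-cong; uniform-rationalMultiple)
  open QuotientGroup A T using (≈⇒≋; lincomb/≡lincomb)

  uniform-multiple : FreeSub A S → ∀ {b} → (∀ x → RationalMultiple x b) →
                     ∃[ M ] M ≢ 0 × (∀ β → (S ∈S) β → (⟨ b ⟩ ∈S) (M · β))
  uniform-multiple (k , bs , _ , _ , spans) {b} ℚb with uniform-rationalMultiple k bs (λ i → ℚb (bs i))
  ... | M , M≢0 , M·span⊆ℤb = M , M≢0 , Mβ∈ℤb
    where
    Mβ∈ℤb : ∀ β → (S ∈S) β → (⟨ b ⟩ ∈S) (M · β)
    Mβ∈ℤb β β∈S with spans β β∈S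
    ... | cs , csbs≈β = resp ⟨ b ⟩ (·-cong M (≈⇒≋ csbs≈β))
      (≡.subst (λ u → (⟨ b ⟩ ∈S) (M · u)) (lincomb/≡lincomb k cs bs) (M·span⊆ℤb cs))

module _ {c ℓ : Level} {A : AbelianGroup c ℓ} where
  open Multiples using (RationalMultiple)

  crossing-charEquiv : (B C : Subgroup A) → TorsionFree (A / B) → TorsionFree (A / C) → FreeSub A B → FreeSub A C →
    ∀ {b c} → (B ∈S) b → ¬ (C ∈S) b → (C ∈S) c → ¬ (B ∈S) c →
    (∀ x → RationalMultiple (A / C) x b) → (∀ x → RationalMultiple (A / B) x c) →
    CharEquiv (QuotHeightGE A B c) (QuotHeightGE A C b)
  crossing-charEquiv B C tfB tfC freeB freeC {b} {c} b∈B b∉C c∈C c∉B ℚb ℚc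
    with uniform-multiple B C freeB ℚb | uniform-multiple C B freeC ℚc
  ... | M' , M'≢0 , M'B⊆ℤb | M , M≢0 , MC⊆ℤc = quotHeight-charEquiv B C {c} {b}
    (dominates⇒charEquiv (*-≢0 M≢0 M'≢0) (*-≢0 M'≢0 M≢0)
      (Crossing.crossing-dominates B C tfB tfC b∈B c∈C c∉B {M} {M'} M'B⊆ℤb MC⊆ℤc)
      (Crossing.crossing-dominates C B tfC tfB c∈C b∈B b∉C {M'} {M} MC⊆ℤc M'B⊆ℤb))

  quotHeight-cong : (B C : Subgroup A) → (∀ z → (B ∈S) z ⇔ (C ∈S) z) →
    ∀ x p k → QuotHeightGE A B x p k ⇔ QuotHeightGE A C x p k
  quotHeight-cong B C B≐C x p k =
    mk⇔ (λ (y , h) → y , Equivalence.to (B≐C _) h) (λ (y , h) → y , Equivalence.from (B≐C _) h)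

lemma7 : {c ℓ : Level} (r : ℕ) (A : AbelianGroup c ℓ) → TorsionFree A → HasRank A (suc r) → (∀ (S : Subgroup A) → HasRankSub A S r → FreeSub A S) → (B C : Subgroup A) → Pure A B → HasRankSub A B r → Pure A C → HasRankSub A C r → SameQuotType A B C
lemma7 r A tf (_ , dependent) free B C pB rB@((vs , vs∈B , vs-ind) , _) pC rC@((ws , ws∈C , ws-ind) , _)
  x y x∉B y∉C =
  [ equal , crossing ]′ (equal-or-crossing B C /B.torsionFree/ /C.torsionFree/ rB rC (/B.∈? x∉B) (/C.∈? y∉C))
  where
  module /B = PureOfCorankOne tf dependent B pB vs vs∈B vs-ind
  module /C = PureOfCorankOne tf dependent C pC ws ws∈C ws-ind
  Goal : Set _
  Goal = CharEquiv (QuotHeightGE A B x) (QuotHeightGE A C y)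
  equal : (∀ z → (B ∈S) z ⇔ (C ∈S) z) → Goal
  equal B≐C = charEquiv-trans (/B.nonzero-charEquiv x∉B (λ y∈B → y∉C (Equivalence.to (B≐C y) y∈B)))
    (⇔⇒charEquiv (quotHeight-cong B C B≐C y))
  crossing : (∃[ b ] (B ∈S) b × ¬ (C ∈S) b) × (∃[ c ] (C ∈S) c × ¬ (B ∈S) c) → Goal
  crossing ((b , b∈B , b∉C) , (c , c∈C , c∉B)) = charEquiv-trans (/B.nonzero-charEquiv x∉B c∉B)
    (charEquiv-trans
      (crossing-charEquiv B C /B.torsionFree/ /C.torsionFree/ (free B rB) (free C rC) b∈B b∉C c∈C c∉B
        (/C.rationalMultiple b∉C) (/B.rationalMultiple c∉B))
      (/C.nonzero-charEquiv b∉C y∉C))
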